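{- Let $n$ be a positive integer and let $v=\{i,j\}$ and $w=\{i',j+1\}$ be vertices of $J(n,2)$ (so $i<j$ and $j+1\le n$), with $i'<i$. Let $S$ be the set of vertices determined by $\{v,w\}$, i.e. the set of all vertices of $J(n,2)$ dominated by $v$ or by $w$. Let $Q=\{\{i',j\},\{i'+1,j\},\dots,\{i-1,j\}\}$ be the set of vertices in column $j$ and in rows $i',\dots,i-1$. Then $S':=S\cup Q$ is a stable set, and \[ \frac{|\partial S'|}{|S'|}\le\frac{|\partial S|}{|S|}. \]
   Context: The Johnson graph $J(n,2)$ has vertex set $\binom{[n]}{2}$, the $2$-element subsets of $[n]=\{1,\dots,n\}$, two vertices being adjacent iff they share exactly one element. A vertex is written $\{a,b\}$ with $a<b$; it is said to lie in row $a$ and column $b$. A vertex $\{a,b\}$ dominates a vertex $\{a',b'\}$ if $a\le a'$ and $b\le b'$ (in particular it dominates itself). A set $S$ of vertices is stable if for every $u\in S$, every vertex dominated by $u$ is also in $S$. For $S\subseteq V$, $\partial S$ denotes the set of edges with exactly one endpoint in $S$. -}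

module Defs where

open import Data.Nat using (ℕ; zero; suc; _+_; _*_; _≤_; _<_; _≤ᵇ_; _<ᵇ_; _≡ᵇ_)
open import Data.Bool using (Bool; true; false; _∧_; _∨_; _xor_; if_then_else_)
open import Data.Product using (_×_; _,_)
open import Data.List using (List; []; _∷_; filter; length; upTo; concatMap; map)
open import Relation.Binary.PropositionalEquality using (_≡_)
open import Relation.Nullary.Decidable using (Dec; yes; no)
open import Data.Bool using (T)
open import Data.Bool.Properties using (T?)

-- A vertex of J(n,2) is a pair (a , b) of naturals with 1 ≤ a < b ≤ n,
-- encoding the 2-subset {a,b} of [n] = {1,…,n} (a = row, b = column).
Vertex : Set
Vertex = ℕ × ℕ

IsVertex : ℕ → Vertex → Set
IsVertex n (a , b) = 1 ≤ a × a < b × b ≤ n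

isVertexᵇ : ℕ → Vertex → Bool
isVertexᵇ n (a , b) = (1 ≤ᵇ a) ∧ (a <ᵇ b) ∧ (b ≤ᵇ n)

vertices : ℕ → List Vertex
vertices n = filter (λ x → T? (isVertexᵇ n x))
  (concatMap (λ a → map (λ b → (a , b)) (upTo (suc n))) (upTo (suc n)))

Dominates : Vertex → Vertex → Set
Dominates (a , b) (a' , b') = a ≤ a' × b ≤ b'

dominatesᵇ : Vertex → Vertex → Bool
dominatesᵇ (a , b) (a' , b') = (a ≤ᵇ a') ∧ (b ≤ᵇ b')

VSet : Set
VSet = Vertex → Bool

_∈ˢ_ : Vertex → VSet → Set
x ∈ˢ A = A x ≡ true

Stable : ℕ → VSet → Set
Stable n A = ∀ u x → u ∈ˢ A → IsVertex n x → Dominates u x → x ∈ˢ A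

card : ℕ → VSet → ℕ
card n A = length (filter (λ x → T? (A x)) (vertices n))

b2n : Bool → ℕ
b2n true = 1
b2n false = 0

common : Vertex → Vertex → ℕ
common (a , b) (c , d) = b2n ((a ≡ᵇ c) ∨ (a ≡ᵇ d)) + b2n ((b ≡ᵇ c) ∨ (b ≡ᵇ d))

adjacentᵇ : Vertex → Vertex → Bool
adjacentᵇ u w = common u w ≡ᵇ 1

-- strict lexicographic order, used to list each (unordered) edge once
lexLtᵇ : Vertex → Vertex → Bool
lexLtᵇ (a , b) (c , d) = (a <ᵇ c) ∨ ((a ≡ᵇ c) ∧ (b <ᵇ d))

edges : ℕ → List (Vertex × Vertex)
edges n = filter (λ { (u , w) → T? (lexLtᵇ u w ∧ adjacentᵇ u w) })
  (concatMap (λ u → map (λ w → (u , w)) (vertices n)) (vertices n))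

boundary : ℕ → VSet → ℕ
boundary n A = length (filter (λ { (u , w) → T? (A u xor A w) }) (edges n))

determined : ℕ → Vertex → Vertex → VSet
determined n v w x = isVertexᵇ n x ∧ (dominatesᵇ v x ∨ dominatesᵇ w x)

columnSeg : ℕ → ℕ → ℕ → VSet
columnSeg i' i j (a , b) = (b ≡ᵇ j) ∧ (i' ≤ᵇ a) ∧ (a <ᵇ i)

_∪ˢ_ : VSet → VSet → VSet
(A ∪ˢ B) x = A x ∨ B x

-- Let k = |Q|, qIn = 2(n − j) + (j − i) and qOut = (j − 2) + (i' − 1). Counting edges by their
-- endpoints, |∂S'| + e(Q, S) = |∂S| + e(Q, V ∖ S'). Every vertex {a, j} of Q has at least qIn
-- neighbours in S and at most qOut outside S', so |∂S'| + k·qIn ≤ |∂S| + k·qOut. On the other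
-- hand, exhibiting for each vertex of S enough neighbours outside S shows, column by column,
-- that the vertices of S have on average at least qOut − qIn such neighbours, that is
-- |S|·qOut ≤ |∂S| + |S|·qIn. The two inequalities combine to |∂S'|·|S| ≤ |∂S|·(|S| + k).
module Submission where

open import Defs
open import Data.Nat using (ℕ; zero; suc; _+_; _*_; _∸_; _⊓_; _≤_; _<_; z≤n; s≤s; _≤ᵇ_; _<ᵇ_; _≡ᵇ_)
open import Data.Nat.Properties
open import Data.Bool using (Bool; true; false; _∧_; _∨_; _xor_; not)
open import Data.Bool.Properties using (T?; T-≡; ∨-zeroʳ)
open import Data.Product using (_×_; _,_; proj₁; proj₂)
open import Data.Sum using (_⊎_; inj₁; inj₂)
open import Data.Empty using (⊥; ⊥-elim)
open import Data.List using (List; []; _∷_; _++_; filter; length; upTo; concatMap; map)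
open import Data.List.Properties using (upTo-∷ʳ)
open import Data.List.Membership.Propositional using (_∈_)
open import Data.List.Membership.Propositional.Properties using (∈-filter⁻; ∈-upTo⁻)
open import Data.List.Relation.Unary.Any using (here; there)
open import Function using (_∘_)
open import Function.Bundles using (Equivalence)
open import Relation.Binary.PropositionalEquality
open import Relation.Binary.Definitions using (Tri; tri<; tri≈; tri>)
open import Relation.Nullary using (¬_; Dec; yes; no)
open import Relation.Nullary.Reflects using (Reflects; ofʸ; ofⁿ; fromEquivalence; _×-reflects_; _⊎-reflects_)
open import Data.Nat.Tactic.RingSolver using (solve-∀)

∑ : {A : Set} → List A → (A → ℕ) → ℕ
∑ [] f = 0
∑ (x ∷ xs) f = f x + ∑ xs f

module _ {A : Set} where

  ∑-++ : (xs ys : List A) (f : A → ℕ) → ∑ (xs ++ ys) f ≡ ∑ xs f + ∑ ys f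
  ∑-++ [] ys f = refl
  ∑-++ (x ∷ xs) ys f = trans (cong (f x +_) (∑-++ xs ys f)) (sym (+-assoc (f x) _ _))

  ∑-cong : (xs : List A) {f g : A → ℕ} → (∀ x → f x ≡ g x) → ∑ xs f ≡ ∑ xs g
  ∑-cong [] h = refl
  ∑-cong (x ∷ xs) h = cong₂ _+_ (h x) (∑-cong xs h)

  ∑-congᴹ : (xs : List A) {f g : A → ℕ} → (∀ x → x ∈ xs → f x ≡ g x) → ∑ xs f ≡ ∑ xs g
  ∑-congᴹ [] h = refl
  ∑-congᴹ (x ∷ xs) h = cong₂ _+_ (h x (here refl)) (∑-congᴹ xs (λ y y∈xs → h y (there y∈xs)))

  ∑-mono-≤ : (xs : List A) {f g : A → ℕ} → (∀ x → f x ≤ g x) → ∑ xs f ≤ ∑ xs g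
  ∑-mono-≤ [] h = z≤n
  ∑-mono-≤ (x ∷ xs) h = +-mono-≤ (h x) (∑-mono-≤ xs h)

  ∑-monoᴹ-≤ : (xs : List A) {f g : A → ℕ} → (∀ x → x ∈ xs → f x ≤ g x) → ∑ xs f ≤ ∑ xs g
  ∑-monoᴹ-≤ [] h = z≤n
  ∑-monoᴹ-≤ (x ∷ xs) h = +-mono-≤ (h x (here refl)) (∑-monoᴹ-≤ xs (λ y y∈xs → h y (there y∈xs)))

  ∑-zero : (xs : List A) → ∑ xs (λ _ → 0) ≡ 0
  ∑-zero [] = refl
  ∑-zero (x ∷ xs) = ∑-zero xs

  ∑-distrib-+ : (xs : List A) (f g : A → ℕ) → ∑ xs (λ x → f x + g x) ≡ ∑ xs f + ∑ xs g
  ∑-distrib-+ [] f g = refl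
  ∑-distrib-+ (x ∷ xs) f g rewrite ∑-distrib-+ xs f g = +-interchange (f x) (g x) (∑ xs f) (∑ xs g)
    where
    +-interchange : ∀ a b c d → a + b + (c + d) ≡ a + c + (b + d)
    +-interchange = solve-∀

  ∑-*ˡ : (xs : List A) (c : ℕ) (f : A → ℕ) → ∑ xs (λ x → c * f x) ≡ c * ∑ xs f
  ∑-*ˡ [] c f = sym (*-zeroʳ c)
  ∑-*ˡ (x ∷ xs) c f rewrite ∑-*ˡ xs c f = sym (*-distribˡ-+ c (f x) (∑ xs f))

  ∑-*ʳ : (xs : List A) (c : ℕ) (f : A → ℕ) → ∑ xs (λ x → f x * c) ≡ ∑ xs f * c
  ∑-*ʳ xs c f = trans (∑-cong xs (λ x → *-comm (f x) c)) (trans (∑-*ˡ xs c f) (*-comm c (∑ xs f)))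

  ∑-filter : (xs : List A) (p : A → Bool) (f : A → ℕ) →
    ∑ (filter (λ x → T? (p x)) xs) f ≡ ∑ xs (λ x → b2n (p x) * f x)
  ∑-filter [] p f = refl
  ∑-filter (x ∷ xs) p f with p x
  ... | true = cong₂ _+_ (sym (+-identityʳ (f x))) (∑-filter xs p f)
  ... | false = ∑-filter xs p f

  length-filter : (xs : List A) (p : A → Bool) →
    length (filter (λ x → T? (p x)) xs) ≡ ∑ xs (λ x → b2n (p x))
  length-filter [] p = refl
  length-filter (x ∷ xs) p with p x
  ... | true = cong suc (length-filter xs p)
  ... | false = length-filter xs p

module _ {A B : Set} where

  ∑-map : (xs : List A) (g : A → B) (f : B → ℕ) → ∑ (map g xs) f ≡ ∑ xs (λ x → f (g x))
  ∑-map [] g f = refl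
  ∑-map (x ∷ xs) g f = cong (f (g x) +_) (∑-map xs g f)

  ∑-concatMap : (xs : List A) (g : A → List B) (f : B → ℕ) →
    ∑ (concatMap g xs) f ≡ ∑ xs (λ x → ∑ (g x) f)
  ∑-concatMap [] g f = refl
  ∑-concatMap (x ∷ xs) g f =
    trans (∑-++ (g x) (concatMap g xs) f) (cong (∑ (g x) f +_) (∑-concatMap xs g f))

  ∑-comm : (xs : List A) (ys : List B) (f : A → B → ℕ) →
    ∑ xs (λ x → ∑ ys (f x)) ≡ ∑ ys (λ y → ∑ xs (λ x → f x y))
  ∑-comm [] ys f = sym (∑-zero ys)
  ∑-comm (x ∷ xs) ys f = trans (cong (∑ ys (f x) +_) (∑-comm xs ys f))
    (sym (∑-distrib-+ ys (f x) (λ y → ∑ xs (λ x' → f x' y))))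

∑-upTo-suc : (m : ℕ) (f : ℕ → ℕ) → ∑ (upTo (suc m)) f ≡ ∑ (upTo m) f + f m
∑-upTo-suc m f = begin
  ∑ (upTo (suc m)) f       ≡⟨ cong (λ xs → ∑ xs f) (sym (upTo-∷ʳ m)) ⟩
  ∑ (upTo m ++ m ∷ []) f   ≡⟨ ∑-++ (upTo m) (m ∷ []) f ⟩
  ∑ (upTo m) f + (f m + 0) ≡⟨ cong (∑ (upTo m) f +_) (+-identityʳ (f m)) ⟩
  ∑ (upTo m) f + f m       ∎
  where open ≡-Reasoning

module _ {P : Set} where

  reflects-sound : ∀ {b} → Reflects P b → b ≡ true → P
  reflects-sound (ofʸ p) _ = p

  reflects-complete : ∀ {b} → Reflects P b → P → b ≡ true
  reflects-complete (ofʸ _) _ = refl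
  reflects-complete (ofⁿ ¬p) p = ⊥-elim (¬p p)

  reflects-refute : ∀ {b} → Reflects P b → ¬ P → b ≡ false
  reflects-refute (ofʸ p) ¬p = ⊥-elim (¬p p)
  reflects-refute (ofⁿ _) _ = refl

  reflects-≡ : ∀ {Q : Set} {a b} → Reflects P a → Reflects Q b → (P → Q) → (Q → P) → a ≡ b
  reflects-≡ (ofʸ _) (ofʸ _) _ _ = refl
  reflects-≡ (ofʸ p) (ofⁿ ¬q) f _ = ⊥-elim (¬q (f p))
  reflects-≡ (ofⁿ ¬p) (ofʸ q) _ g = ⊥-elim (¬p (g q))
  reflects-≡ (ofⁿ _) (ofⁿ _) _ _ = refl

≡ᵇ-reflects-≡ : ∀ m n → Reflects (m ≡ n) (m ≡ᵇ n)
≡ᵇ-reflects-≡ m n = fromEquivalence (≡ᵇ⇒≡ m n) (≡⇒≡ᵇ m n)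

≡ᵇ-refl : ∀ m → (m ≡ᵇ m) ≡ true
≡ᵇ-refl m = reflects-complete (≡ᵇ-reflects-≡ m m) refl

≡ᵇ-false : ∀ {m n} → m ≢ n → (m ≡ᵇ n) ≡ false
≡ᵇ-false {m} {n} = reflects-refute (≡ᵇ-reflects-≡ m n)

≡ᵇ-comm : ∀ m n → (m ≡ᵇ n) ≡ (n ≡ᵇ m)
≡ᵇ-comm m n = reflects-≡ (≡ᵇ-reflects-≡ m n) (≡ᵇ-reflects-≡ n m) sym sym

<ᵇ-true : ∀ {m n} → m < n → (m <ᵇ n) ≡ true
<ᵇ-true {m} {n} = reflects-complete (<ᵇ-reflects-< m n)

<ᵇ-false : ∀ {m n} → n ≤ m → (m <ᵇ n) ≡ false
<ᵇ-false {m} {n} n≤m = reflects-refute (<ᵇ-reflects-< m n) (≤⇒≯ n≤m)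

b2n-∧ : ∀ x y → b2n (x ∧ y) ≡ b2n x * b2n y
b2n-∧ true y = sym (+-identityʳ (b2n y))
b2n-∧ false y = refl

b2n-*-monoʳ-≤ : ∀ x {m n} → (x ≡ true → m ≤ n) → b2n x * m ≤ b2n x * n
b2n-*-monoʳ-≤ true m≤n = *-monoʳ-≤ 1 (m≤n refl)
b2n-*-monoʳ-≤ false _ = z≤n

Interval : ℕ → ℕ → ℕ → Set
Interval l u y = l ≤ y × y < u

intervalᵇ : ℕ → ℕ → ℕ → Bool
intervalᵇ l u y = (l ≤ᵇ y) ∧ (y <ᵇ u)

interval-reflects : ∀ l u y → Reflects (Interval l u y) (intervalᵇ l u y)
interval-reflects l u y = ≤ᵇ-reflects-≤ l y ×-reflects <ᵇ-reflects-< y u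

intervalᵇ-split : ∀ {l m u} → l ≤ m → m ≤ u → ∀ y →
  b2n (intervalᵇ l u y) ≡ b2n (intervalᵇ l m y) + b2n (intervalᵇ m u y)
intervalᵇ-split {l} {m} {u} l≤m m≤u y with m ≤? y
... | yes m≤y
  rewrite reflects-refute (interval-reflects l m y) (≤⇒≯ m≤y ∘ proj₂)
        | reflects-≡ (interval-reflects l u y) (interval-reflects m u y)
            (λ (_ , y<u) → m≤y , y<u) (λ (_ , y<u) → ≤-trans l≤m m≤y , y<u) = refl
... | no m≰y
  rewrite reflects-refute (interval-reflects m u y) (m≰y ∘ proj₁)
        | reflects-≡ (interval-reflects l u y) (interval-reflects l m y)
            (λ (l≤y , _) → l≤y , ≰⇒> m≰y) (λ (l≤y , y<m) → l≤y , <-≤-trans y<m m≤u) =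
  sym (+-identityʳ _)

∑-intervalᵇ-split : ∀ {l m u} → l ≤ m → m ≤ u → ∀ xs (f : ℕ → ℕ) →
  ∑ xs (λ y → b2n (intervalᵇ l u y) * f y) ≡
  ∑ xs (λ y → b2n (intervalᵇ l m y) * f y) + ∑ xs (λ y → b2n (intervalᵇ m u y) * f y)
∑-intervalᵇ-split {l} {m} {u} l≤m m≤u xs f = trans (∑-cong xs (λ y →
    trans (cong (_* f y) (intervalᵇ-split l≤m m≤u y))
          (*-distribʳ-+ (f y) (b2n (intervalᵇ l m y)) (b2n (intervalᵇ m u y)))))
  (∑-distrib-+ xs _ _)

∑-upTo-indicator : ∀ {m c} (f : ℕ → ℕ) → c < m → ∑ (upTo m) (λ y → b2n (y ≡ᵇ c) * f y) ≡ f c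
∑-upTo-indicator {suc m} {c} f c<1+m = trans (∑-upTo-suc m g) (last (<-cmp c m))
  where
  g : ℕ → ℕ
  g y = b2n (y ≡ᵇ c) * f y
  last : Tri (c < m) (c ≡ m) (m < c) → ∑ (upTo m) g + g m ≡ f c
  last (tri< c<m _ _) rewrite ≡ᵇ-false (>⇒≢ c<m) = trans (+-identityʳ _) (∑-upTo-indicator f c<m)
  last (tri≈ _ refl _) rewrite ≡ᵇ-refl c =
    cong₂ _+_ (trans (∑-congᴹ (upTo c) vanish) (∑-zero (upTo c))) (+-identityʳ (f c))
    where
    vanish : ∀ y → y ∈ upTo c → g y ≡ 0
    vanish y y∈ rewrite ≡ᵇ-false (<⇒≢ (∈-upTo⁻ y∈)) = refl
  last (tri> _ _ m<c) = ⊥-elim (<⇒≱ c<1+m m<c)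

-- The cap ⊓ m is what makes the induction on m go through.
∑-upTo-intervalᵇ⊓ : ∀ m l u → ∑ (upTo m) (λ y → b2n (intervalᵇ l u y)) ≡ (u ⊓ m) ∸ l
∑-upTo-intervalᵇ⊓ zero l u = trans (sym (0∸n≡0 l)) (cong (_∸ l) (sym (⊓-zeroʳ u)))
∑-upTo-intervalᵇ⊓ (suc m) l u = begin
  ∑ (upTo (suc m)) I                 ≡⟨ ∑-upTo-suc m I ⟩
  ∑ (upTo m) I + I m                 ≡⟨ cong (_+ I m) (∑-upTo-intervalᵇ⊓ m l u) ⟩
  (u ⊓ m) ∸ l + I m                  ≡⟨ step (m <? u) (l ≤? m) ⟩
  (u ⊓ suc m) ∸ l                    ∎
  where
  open ≡-Reasoning
  I : ℕ → ℕ
  I y = b2n (intervalᵇ l u y)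
  step : Dec (m < u) → Dec (l ≤ m) → (u ⊓ m) ∸ l + I m ≡ (u ⊓ suc m) ∸ l
  step (yes m<u) (yes l≤m)
    rewrite reflects-complete (interval-reflects l u m) (l≤m , m<u)
          | m≥n⇒m⊓n≡n (<⇒≤ m<u) | m≥n⇒m⊓n≡n m<u = trans (+-comm (m ∸ l) 1) (sym (+-∸-assoc 1 l≤m))
  step (yes m<u) (no l≰m)
    rewrite reflects-refute (interval-reflects l u m) (l≰m ∘ proj₁)
          | m≥n⇒m⊓n≡n (<⇒≤ m<u) | m≥n⇒m⊓n≡n m<u =
    trans (+-identityʳ _) (trans (m≤n⇒m∸n≡0 (<⇒≤ (≰⇒> l≰m))) (sym (m≤n⇒m∸n≡0 (≰⇒> l≰m))))
  step (no m≮u) _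
    rewrite reflects-refute (interval-reflects l u m) (m≮u ∘ proj₂)
          | m≤n⇒m⊓n≡m (≮⇒≥ m≮u) | m≤n⇒m⊓n≡m (m≤n⇒m≤1+n (≮⇒≥ m≮u)) = +-identityʳ _

∑-upTo-intervalᵇ : ∀ {m} l u → u ≤ m → ∑ (upTo m) (λ y → b2n (intervalᵇ l u y)) ≡ u ∸ l
∑-upTo-intervalᵇ {m} l u u≤m = trans (∑-upTo-intervalᵇ⊓ m l u) (cong (_∸ l) (m≤n⇒m⊓n≡m u≤m))

∑-upTo-intervalᵇ-≥ : ∀ {m l u c} (f : ℕ → ℕ) → u ≤ m → (∀ y → Interval l u y → c ≤ f y) →
  (u ∸ l) * c ≤ ∑ (upTo m) (λ y → b2n (intervalᵇ l u y) * f y)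
∑-upTo-intervalᵇ-≥ {m} {l} {u} {c} f u≤m c≤f = begin
  (u ∸ l) * c                                     ≡⟨ cong (_* c) (∑-upTo-intervalᵇ l u u≤m) ⟨
  ∑ (upTo m) (λ y → b2n (intervalᵇ l u y)) * c    ≡⟨ ∑-*ʳ (upTo m) c _ ⟨
  ∑ (upTo m) (λ y → b2n (intervalᵇ l u y) * c)    ≤⟨ ∑-mono-≤ (upTo m) bound ⟩
  ∑ (upTo m) (λ y → b2n (intervalᵇ l u y) * f y)  ∎
  where
  open ≤-Reasoning
  bound : ∀ y → b2n (intervalᵇ l u y) * c ≤ b2n (intervalᵇ l u y) * f y
  bound y = b2n-*-monoʳ-≤ (intervalᵇ l u y) (c≤f y ∘ reflects-sound (interval-reflects l u y))

-- Vertex sets of J(n,2)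

isVertex-reflects : ∀ n x → Reflects (IsVertex n x) (isVertexᵇ n x)
isVertex-reflects n (a , b) = ≤ᵇ-reflects-≤ 1 a ×-reflects <ᵇ-reflects-< a b ×-reflects ≤ᵇ-reflects-≤ b n

dominates-reflects : ∀ u x → Reflects (Dominates u x) (dominatesᵇ u x)
dominates-reflects (a , b) (a' , b') = ≤ᵇ-reflects-≤ a a' ×-reflects ≤ᵇ-reflects-≤ b b'

Determined : ℕ → Vertex → Vertex → Vertex → Set
Determined n v w x = IsVertex n x × (Dominates v x ⊎ Dominates w x)

determined-reflects : ∀ n v w x → Reflects (Determined n v w x) (determined n v w x)
determined-reflects n v w x =
  isVertex-reflects n x ×-reflects (dominates-reflects v x ⊎-reflects dominates-reflects w x)

dominates-trans : ∀ {u v x} → Dominates u v → Dominates v x → Dominates u x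
dominates-trans (a≤b , c≤d) (b≤e , d≤f) = ≤-trans a≤b b≤e , ≤-trans c≤d d≤f

<⇒¬Dominates : ∀ {l m a b} → a < l ⊎ b < m → ¬ Dominates (l , m) (a , b)
<⇒¬Dominates (inj₁ a<l) (l≤a , _) = <⇒≱ a<l l≤a
<⇒¬Dominates (inj₂ b<m) (_ , m≤b) = <⇒≱ b<m m≤b

determined-stable : ∀ n v w → Stable n (determined n v w)
determined-stable n v w u x u∈ x∈V u≼x with reflects-sound (determined-reflects n v w u) u∈
... | _ , inj₁ v≼u = reflects-complete (determined-reflects n v w x) (x∈V , inj₁ (dominates-trans {v} v≼u u≼x))
... | _ , inj₂ w≼u = reflects-complete (determined-reflects n v w x) (x∈V , inj₂ (dominates-trans {w} w≼u u≼x))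

ColumnSeg : ℕ → ℕ → ℕ → Vertex → Set
ColumnSeg l u c (a , b) = b ≡ c × Interval l u a

columnSeg-reflects : ∀ l u c x → Reflects (ColumnSeg l u c x) (columnSeg l u c x)
columnSeg-reflects l u c (a , b) = ≡ᵇ-reflects-≡ b c ×-reflects interval-reflects l u a

rowSeg : ℕ → ℕ → ℕ → VSet
rowSeg l u r (a , b) = (a ≡ᵇ r) ∧ intervalᵇ l u b

RowSeg : ℕ → ℕ → ℕ → Vertex → Set
RowSeg l u r (a , b) = a ≡ r × Interval l u b

rowSeg-reflects : ∀ l u r x → Reflects (RowSeg l u r x) (rowSeg l u r x)
rowSeg-reflects l u r (a , b) = ≡ᵇ-reflects-≡ a r ×-reflects interval-reflects l u b

∁ˢ : VSet → VSet
∁ˢ A x = not (A x)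

_⊆ˢ_ : VSet → VSet → Set
A ⊆ˢ B = ∀ x → x ∈ˢ A → x ∈ˢ B

Disjointˢ : VSet → VSet → Set
Disjointˢ A B = ∀ x → x ∈ˢ A → x ∈ˢ B → ⊥

∈∪⁻ : ∀ {A B} x → x ∈ˢ (A ∪ˢ B) → x ∈ˢ A ⊎ x ∈ˢ B
∈∪⁻ {A} x x∈ with A x
... | true = inj₁ refl
... | false = inj₂ x∈

∈∪⁺ : ∀ {A B} x → x ∈ˢ A ⊎ x ∈ˢ B → x ∈ˢ (A ∪ˢ B)
∈∪⁺ {A} x (inj₁ x∈A) rewrite x∈A = refl
∈∪⁺ {A} {B} x (inj₂ x∈B) rewrite x∈B = ∨-zeroʳ (A x)

∉⇒∈∁ : ∀ A x → A x ≡ false → x ∈ˢ ∁ˢ A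
∉⇒∈∁ A x x∉A = cong not x∉A

∈∁∪⁻ : ∀ A B x → x ∈ˢ ∁ˢ (A ∪ˢ B) → A x ≡ false × B x ≡ false
∈∁∪⁻ A B x x∉ with A x | B x
... | false | false = refl , refl

∈-∉ : ∀ A x → x ∈ˢ A → A x ≡ false → ⊥
∈-∉ A x x∈A x∉A with trans (sym x∈A) x∉A
... | ()

b2n-∪ : ∀ {A B} → Disjointˢ A B → ∀ x → b2n ((A ∪ˢ B) x) ≡ b2n (A x) + b2n (B x)
b2n-∪ {A} {B} A∩B=∅ x with A x in x∈A | B x in x∈B
... | true  | true  = ⊥-elim (A∩B=∅ x x∈A x∈B)
... | true  | false = refl
... | false | _     = refl

b2n-∪-≤ : ∀ A B x → b2n ((A ∪ˢ B) x) ≤ b2n (A x) + b2n (B x)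
b2n-∪-≤ A B x with A x
... | true = s≤s z≤n
... | false = ≤-refl

b2n-mono : ∀ {A B} → A ⊆ˢ B → ∀ x → b2n (A x) ≤ b2n (B x)
b2n-mono {A} A⊆B x with A x in x∈A
... | true rewrite A⊆B x x∈A = ≤-refl
... | false = z≤n

∪-⊆ : ∀ {A B C} → A ⊆ˢ C → B ⊆ˢ C → (A ∪ˢ B) ⊆ˢ C
∪-⊆ {A} {B} A⊆C B⊆C x x∈ with ∈∪⁻ {A} {B} x x∈
... | inj₁ x∈A = A⊆C x x∈A
... | inj₂ x∈B = B⊆C x x∈B

∪-disjoint : ∀ {A B C} → Disjointˢ A C → Disjointˢ B C → Disjointˢ (A ∪ˢ B) C
∪-disjoint {A} {B} A∩C=∅ B∩C=∅ x x∈ x∈C with ∈∪⁻ {A} {B} x x∈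
... | inj₁ x∈A = A∩C=∅ x x∈A x∈C
... | inj₂ x∈B = B∩C=∅ x x∈B x∈C

grid : ℕ → List Vertex
grid n = concatMap (λ a → map (λ b → (a , b)) (upTo (suc n))) (upTo (suc n))

∑-grid : ∀ n (f : Vertex → ℕ) →
  ∑ (grid n) f ≡ ∑ (upTo (suc n)) (λ a → ∑ (upTo (suc n)) (λ b → f (a , b)))
∑-grid n f = trans (∑-concatMap (upTo (suc n)) (λ a → map (λ b → (a , b)) (upTo (suc n))) f)
  (∑-cong (upTo (suc n)) (λ a → ∑-map (upTo (suc n)) (λ b → (a , b)) f))

∈vertices⇒IsVertex : ∀ {n x} → x ∈ vertices n → IsVertex n x
∈vertices⇒IsVertex {n} {x} x∈ =
  reflects-sound (isVertex-reflects n x)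
    (Equivalence.to T-≡ (proj₂ (∈-filter⁻ (λ y → T? (isVertexᵇ n y)) {xs = grid n} x∈)))

count : ℕ → VSet → ℕ
count n X = ∑ (grid n) (λ x → b2n (X x))

count-mono : ∀ {n A B} → A ⊆ˢ B → count n A ≤ count n B
count-mono {n} A⊆B = ∑-mono-≤ (grid n) (b2n-mono A⊆B)

count-∪ : ∀ {n A B} → Disjointˢ A B → count n (A ∪ˢ B) ≡ count n A + count n B
count-∪ {n} {A} {B} A∩B=∅ =
  trans (∑-cong (grid n) (b2n-∪ A∩B=∅)) (∑-distrib-+ (grid n) (b2n ∘ A) (b2n ∘ B))

count-∪-≤ : ∀ {n} A B → count n (A ∪ˢ B) ≤ count n A + count n B
count-∪-≤ {n} A B =
  ≤-trans (∑-mono-≤ (grid n) (b2n-∪-≤ A B)) (≤-reflexive (∑-distrib-+ (grid n) (b2n ∘ A) (b2n ∘ B)))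

count-disjoint-≤ : ∀ {n A B C} → Disjointˢ A B → A ⊆ˢ C → B ⊆ˢ C → count n A + count n B ≤ count n C
count-disjoint-≤ {n} {A} {B} A∩B=∅ A⊆C B⊆C =
  ≤-trans (≤-reflexive (sym (count-∪ {n} A∩B=∅))) (count-mono {n} (∪-⊆ A⊆C B⊆C))

count-columnSeg : ∀ {n c} l u → c ≤ n → u ≤ suc n → count n (columnSeg l u c) ≡ u ∸ l
count-columnSeg {n} {c} l u c≤n u≤1+n = begin
  count n (columnSeg l u c)
    ≡⟨ ∑-grid n _ ⟩
  ∑ N (λ a → ∑ N (λ b → b2n ((b ≡ᵇ c) ∧ intervalᵇ l u a)))
    ≡⟨ ∑-cong N (λ a → trans (∑-cong N (λ b → b2n-∧ (b ≡ᵇ c) _))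
                             (∑-upTo-indicator (λ _ → b2n (intervalᵇ l u a)) (s≤s c≤n))) ⟩
  ∑ N (λ a → b2n (intervalᵇ l u a))
    ≡⟨ ∑-upTo-intervalᵇ l u u≤1+n ⟩
  u ∸ l ∎
  where
  open ≡-Reasoning
  N = upTo (suc n)

count-rowSeg : ∀ {n r} l u → r ≤ n → u ≤ suc n → count n (rowSeg l u r) ≡ u ∸ l
count-rowSeg {n} {r} l u r≤n u≤1+n = begin
  count n (rowSeg l u r)
    ≡⟨ ∑-grid n _ ⟩
  ∑ N (λ a → ∑ N (λ b → b2n ((a ≡ᵇ r) ∧ intervalᵇ l u b)))
    ≡⟨ ∑-cong N (λ a → trans (∑-cong N (λ b → b2n-∧ (a ≡ᵇ r) _))
                     (trans (∑-*ˡ N (b2n (a ≡ᵇ r)) _) (cong (b2n (a ≡ᵇ r) *_) (∑-upTo-intervalᵇ l u u≤1+n)))) ⟩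
  ∑ N (λ a → b2n (a ≡ᵇ r) * (u ∸ l))
    ≡⟨ ∑-upTo-indicator (λ _ → u ∸ l) (s≤s r≤n) ⟩
  u ∸ l ∎
  where
  open ≡-Reasoning
  N = upTo (suc n)

columnSeg-disjoint : ∀ l u c l' u' c' → c ≢ c' → Disjointˢ (columnSeg l u c) (columnSeg l' u' c')
columnSeg-disjoint l u c l' u' c' c≢c' x x∈ x∈' =
  c≢c' (trans (sym (proj₁ (reflects-sound (columnSeg-reflects l u c x) x∈)))
              (proj₁ (reflects-sound (columnSeg-reflects l' u' c' x) x∈')))

rowSeg-disjoint : ∀ l u r l' u' r' → r ≢ r' → Disjointˢ (rowSeg l u r) (rowSeg l' u' r')
rowSeg-disjoint l u r l' u' r' r≢r' x x∈ x∈' =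
  r≢r' (trans (sym (proj₁ (reflects-sound (rowSeg-reflects l u r x) x∈)))
              (proj₁ (reflects-sound (rowSeg-reflects l' u' r' x) x∈')))

rowSeg-columnSeg-disjoint : ∀ l u r l' u' c → ¬ (Interval l u c × Interval l' u' r) →
  Disjointˢ (rowSeg l u r) (columnSeg l' u' c)
rowSeg-columnSeg-disjoint l u r l' u' c ¬corner x x∈row x∈col
  with reflects-sound (rowSeg-reflects l u r x) x∈row | reflects-sound (columnSeg-reflects l' u' c x) x∈col
... | refl , b∈ | refl , a∈ = ¬corner (b∈ , a∈)

common-∨ : ∀ a {c d} → c ≢ d → b2n ((a ≡ᵇ c) ∨ (a ≡ᵇ d)) ≡ b2n (a ≡ᵇ c) + b2n (a ≡ᵇ d)
common-∨ a {c} {d} c≢d with a ≡ᵇ c in a≡ᵇc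
... | false = refl
... | true rewrite ≡ᵇ-false {a} {d} (c≢d ∘ trans (sym (reflects-sound (≡ᵇ-reflects-≡ a c) a≡ᵇc))) = refl

common-comm : ∀ {a b c d} → a ≢ b → c ≢ d → common (a , b) (c , d) ≡ common (c , d) (a , b)
common-comm {a} {b} {c} {d} a≢b c≢d
  rewrite common-∨ a c≢d | common-∨ b c≢d | common-∨ c a≢b | common-∨ d a≢b
        | ≡ᵇ-comm c a | ≡ᵇ-comm c b | ≡ᵇ-comm d a | ≡ᵇ-comm d b =
  interchange (b2n (a ≡ᵇ c)) (b2n (a ≡ᵇ d)) (b2n (b ≡ᵇ c)) (b2n (b ≡ᵇ d))
  where
  interchange : ∀ w x y z → w + x + (y + z) ≡ w + y + (x + z)
  interchange = solve-∀

adjacent-comm : ∀ {n u w} → IsVertex n u → IsVertex n w → adjacentᵇ u w ≡ adjacentᵇ w u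
adjacent-comm (_ , a<b , _) (_ , c<d , _) = cong (_≡ᵇ 1) (common-comm (<⇒≢ a<b) (<⇒≢ c<d))

-- Of two distinct vertices exactly one precedes the other, and adjacent vertices are distinct.
adjacent-lex : ∀ u w → b2n (adjacentᵇ u w) * (b2n (lexLtᵇ u w) + b2n (lexLtᵇ w u)) ≡ b2n (adjacentᵇ u w)
adjacent-lex (a , b) (c , d) with <-cmp a c
... | tri< a<c _ _ rewrite <ᵇ-true a<c | <ᵇ-false (<⇒≤ a<c) | ≡ᵇ-false (>⇒≢ a<c) = *-identityʳ _
... | tri> _ _ c<a rewrite <ᵇ-true c<a | <ᵇ-false (<⇒≤ c<a) | ≡ᵇ-false (>⇒≢ c<a) = *-identityʳ _
... | tri≈ _ refl _ rewrite <ᵇ-false (≤-refl {a}) | ≡ᵇ-refl a with <-cmp b d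
...   | tri< b<d _ _ rewrite <ᵇ-true b<d | <ᵇ-false (<⇒≤ b<d) = *-identityʳ _
...   | tri> _ _ d<b rewrite <ᵇ-true d<b | <ᵇ-false (<⇒≤ d<b) = *-identityʳ _
...   | tri≈ _ refl _ rewrite ≡ᵇ-refl b | ∨-zeroʳ (b ≡ᵇ a) = refl

adjacent-column : ∀ {a b c} → a ≢ c → a ≢ b → adjacentᵇ (a , b) (c , b) ≡ true
adjacent-column {a} {b} {c} a≢c a≢b rewrite ≡ᵇ-false a≢c | ≡ᵇ-false a≢b | ≡ᵇ-refl b | ∨-zeroʳ (b ≡ᵇ c) = refl

adjacent-row : ∀ {a b d} → b ≢ a → b ≢ d → adjacentᵇ (a , b) (a , d) ≡ true
adjacent-row {a} b≢a b≢d rewrite ≡ᵇ-refl a | ≡ᵇ-false b≢a | ≡ᵇ-false b≢d = refl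

adjacent-row-column : ∀ {a b c} → b ≢ c → b ≢ a → adjacentᵇ (a , b) (c , a) ≡ true
adjacent-row-column {a} {b} {c} b≢c b≢a rewrite ≡ᵇ-refl a | ∨-zeroʳ (a ≡ᵇ c) | ≡ᵇ-false b≢c | ≡ᵇ-false b≢a = refl

adjacent-column-row : ∀ {a b d} → a ≢ b → a ≢ d → adjacentᵇ (a , b) (b , d) ≡ true
adjacent-column-row {b = b} a≢b a≢d rewrite ≡ᵇ-false a≢b | ≡ᵇ-false a≢d | ≡ᵇ-refl b = refl

adjacent⇒shares : ∀ a b c d → adjacentᵇ (a , b) (c , d) ≡ true → a ≡ c ⊎ a ≡ d ⊎ b ≡ c ⊎ b ≡ d
adjacent⇒shares a b c d adj with a ≟ c | a ≟ d | b ≟ c | b ≟ d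
... | yes a≡c | _ | _ | _ = inj₁ a≡c
... | no _ | yes a≡d | _ | _ = inj₂ (inj₁ a≡d)
... | no _ | no _ | yes b≡c | _ = inj₂ (inj₂ (inj₁ b≡c))
... | no _ | no _ | no _ | yes b≡d = inj₂ (inj₂ (inj₂ b≡d))
... | no a≢c | no a≢d | no b≢c | no b≢d
  rewrite ≡ᵇ-false a≢c | ≡ᵇ-false a≢d | ≡ᵇ-false b≢c | ≡ᵇ-false b≢d with adj
... | ()

-- Degrees and edge boundaries

∑∈ : ℕ → VSet → (Vertex → ℕ) → ℕ
∑∈ n A f = ∑ (vertices n) (λ x → b2n (A x) * f x)

degree : ℕ → VSet → Vertex → ℕ
degree n X u = ∑∈ n X (λ w → b2n (adjacentᵇ u w))

neighbours : ℕ → VSet → Vertex → VSet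
neighbours n X u x = isVertexᵇ n x ∧ (adjacentᵇ u x ∧ X x)

∑∈-const : ∀ n A c → ∑∈ n A (λ _ → c) ≡ card n A * c
∑∈-const n A c = trans (∑-*ʳ (vertices n) c (b2n ∘ A)) (cong (_* c) (sym (length-filter (vertices n) A)))

∑∈-distrib-+ : ∀ n A (f g : Vertex → ℕ) → ∑∈ n A (λ x → f x + g x) ≡ ∑∈ n A f + ∑∈ n A g
∑∈-distrib-+ n A f g = trans (∑-cong (vertices n) (λ x → *-distribˡ-+ (b2n (A x)) (f x) (g x)))
  (∑-distrib-+ (vertices n) _ _)

∑∈-∪ : ∀ n {A B} f → Disjointˢ A B → ∑∈ n (A ∪ˢ B) f ≡ ∑∈ n A f + ∑∈ n B f
∑∈-∪ n {A} {B} f A∩B=∅ = trans (∑-cong (vertices n) (λ x →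
    trans (cong (_* f x) (b2n-∪ A∩B=∅ x)) (*-distribʳ-+ (f x) (b2n (A x)) (b2n (B x)))))
  (∑-distrib-+ (vertices n) _ _)

∑∈-mono-≤ : ∀ n A {f g} → (∀ x → x ∈ˢ A → f x ≤ g x) → ∑∈ n A f ≤ ∑∈ n A g
∑∈-mono-≤ n A f≤g = ∑-mono-≤ (vertices n) (λ x → b2n-*-monoʳ-≤ (A x) (f≤g x))

card-∪ : ∀ n {A B} → Disjointˢ A B → card n (A ∪ˢ B) ≡ card n A + card n B
card-∪ n {A} {B} A∩B=∅ = begin
  card n (A ∪ˢ B)                                  ≡⟨ length-filter V (A ∪ˢ B) ⟩
  ∑ V (λ x → b2n ((A ∪ˢ B) x))                     ≡⟨ ∑-cong V (b2n-∪ A∩B=∅) ⟩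
  ∑ V (λ x → b2n (A x) + b2n (B x))                ≡⟨ ∑-distrib-+ V (b2n ∘ A) (b2n ∘ B) ⟩
  ∑ V (λ x → b2n (A x)) + ∑ V (λ x → b2n (B x))    ≡⟨ cong₂ _+_ (length-filter V A) (length-filter V B) ⟨
  card n A + card n B                              ∎
  where
  open ≡-Reasoning
  V = vertices n

∑∈-cong : ∀ n A {f g} → (∀ x → f x ≡ g x) → ∑∈ n A f ≡ ∑∈ n A g
∑∈-cong n A f≡g = ∑-cong (vertices n) (λ x → cong (b2n (A x) *_) (f≡g x))

card-*-≤-∑∈ : ∀ n A {c f} → (∀ x → x ∈ˢ A → c ≤ f x) → card n A * c ≤ ∑∈ n A f
card-*-≤-∑∈ n A {c} c≤f = ≤-trans (≤-reflexive (sym (∑∈-const n A c))) (∑∈-mono-≤ n A c≤f)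

∑∈-≤-card-* : ∀ n A {c f} → (∀ x → x ∈ˢ A → f x ≤ c) → ∑∈ n A f ≤ card n A * c
∑∈-≤-card-* n A {c} f≤c = ≤-trans (∑∈-mono-≤ n A f≤c) (≤-reflexive (∑∈-const n A c))

∑∈-by-columns : ∀ n A f → A ⊆ˢ isVertexᵇ n →
  ∑∈ n A f ≡ ∑ (upTo (suc n)) (λ c → ∑ (upTo (suc n)) (λ r → b2n (A (r , c)) * f (r , c)))
∑∈-by-columns n A f A⊆V = begin
  ∑∈ n A f
    ≡⟨ ∑-filter (grid n) (isVertexᵇ n) _ ⟩
  ∑ (grid n) (λ x → b2n (isVertexᵇ n x) * (b2n (A x) * f x))
    ≡⟨ ∑-cong (grid n) inside ⟩
  ∑ (grid n) (λ x → b2n (A x) * f x)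
    ≡⟨ ∑-grid n _ ⟩
  ∑ N (λ r → ∑ N (λ c → b2n (A (r , c)) * f (r , c)))
    ≡⟨ ∑-comm N N _ ⟩
  ∑ N (λ c → ∑ N (λ r → b2n (A (r , c)) * f (r , c))) ∎
  where
  open ≡-Reasoning
  N = upTo (suc n)
  inside : ∀ x → b2n (isVertexᵇ n x) * (b2n (A x) * f x) ≡ b2n (A x) * f x
  inside x with A x in x∈A
  ... | true rewrite A⊆V x x∈A = +-identityʳ _
  ... | false = *-zeroʳ (b2n (isVertexᵇ n x))

degree≡count : ∀ n X u → degree n X u ≡ count n (neighbours n X u)
degree≡count n X u = trans (∑-filter (grid n) (isVertexᵇ n) _) (∑-cong (grid n) (λ x → begin
  b2n (isVertexᵇ n x) * (b2n (X x) * b2n (adjacentᵇ u x))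
    ≡⟨ cong (b2n (isVertexᵇ n x) *_) (trans (*-comm (b2n (X x)) _) (sym (b2n-∧ (adjacentᵇ u x) (X x)))) ⟩
  b2n (isVertexᵇ n x) * b2n (adjacentᵇ u x ∧ X x)
    ≡⟨ b2n-∧ (isVertexᵇ n x) _ ⟨
  b2n (neighbours n X u x) ∎))
  where open ≡-Reasoning

∈neighbours⁺ : ∀ {n X u x} → IsVertex n x → adjacentᵇ u x ≡ true → x ∈ˢ X → x ∈ˢ neighbours n X u
∈neighbours⁺ {n} {x = x} x∈V adj x∈X rewrite reflects-complete (isVertex-reflects n x) x∈V | adj | x∈X = refl

∈neighbours⁻ : ∀ {n X u} x → x ∈ˢ neighbours n X u → IsVertex n x × adjacentᵇ u x ≡ true × x ∈ˢ X
∈neighbours⁻ {n} {X} {u} x x∈ with isVertexᵇ n x in x∈V | adjacentᵇ u x in adj | X x in x∈X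
... | true | true | true = reflects-sound (isVertex-reflects n x) x∈V , refl , refl

module _ {n : ℕ} (X : VSet) (u : Vertex) where

  degree-≥-disjoint₂ : ∀ A B → Disjointˢ A B → A ⊆ˢ neighbours n X u → B ⊆ˢ neighbours n X u →
    count n A + count n B ≤ degree n X u
  degree-≥-disjoint₂ A B A∩B=∅ A⊆N B⊆N =
    ≤-trans (count-disjoint-≤ {n} A∩B=∅ A⊆N B⊆N) (≤-reflexive (sym (degree≡count n X u)))

  degree-≥-disjoint₃ : ∀ A B C → Disjointˢ A B → Disjointˢ A C → Disjointˢ B C →
    A ⊆ˢ neighbours n X u → B ⊆ˢ neighbours n X u → C ⊆ˢ neighbours n X u →
    count n A + count n B + count n C ≤ degree n X u
  degree-≥-disjoint₃ A B C A∩B=∅ A∩C=∅ B∩C=∅ A⊆N B⊆N C⊆N = begin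
    count n A + count n B + count n C  ≡⟨ cong (_+ count n C) (count-∪ {n} A∩B=∅) ⟨
    count n (A ∪ˢ B) + count n C       ≤⟨ degree-≥-disjoint₂ (A ∪ˢ B) C (∪-disjoint A∩C=∅ B∩C=∅) (∪-⊆ A⊆N B⊆N) C⊆N ⟩
    degree n X u                       ∎
    where open ≤-Reasoning

  degree-≤-cover₃ : ∀ A B C → (∀ x → x ∈ˢ neighbours n X u → x ∈ˢ A ⊎ x ∈ˢ B ⊎ x ∈ˢ C) →
    degree n X u ≤ count n A + count n B + count n C
  degree-≤-cover₃ A B C cover = begin
    degree n X u                        ≡⟨ degree≡count n X u ⟩
    count n (neighbours n X u)          ≤⟨ count-mono {n} (λ x x∈N → ∈∪⁺ {A ∪ˢ B} {C} x (regroup x (cover x x∈N))) ⟩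
    count n ((A ∪ˢ B) ∪ˢ C)             ≤⟨ count-∪-≤ {n} (A ∪ˢ B) C ⟩
    count n (A ∪ˢ B) + count n C        ≤⟨ +-monoˡ-≤ (count n C) (count-∪-≤ {n} A B) ⟩
    count n A + count n B + count n C   ∎
    where
    open ≤-Reasoning
    regroup : ∀ x → x ∈ˢ A ⊎ x ∈ˢ B ⊎ x ∈ˢ C → x ∈ˢ (A ∪ˢ B) ⊎ x ∈ˢ C
    regroup x (inj₁ x∈A) = inj₁ (∈∪⁺ {A} {B} x (inj₁ x∈A))
    regroup x (inj₂ (inj₁ x∈B)) = inj₁ (∈∪⁺ {A} {B} x (inj₂ x∈B))
    regroup x (inj₂ (inj₂ x∈C)) = inj₂ x∈C

∑∑ : ℕ → (Vertex → Vertex → ℕ) → ℕ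
∑∑ n F = ∑ (vertices n) (λ u → ∑ (vertices n) (F u))

module _ (n : ℕ) where

  ∑∑-cong : ∀ {F G} → (∀ u w → F u w ≡ G u w) → ∑∑ n F ≡ ∑∑ n G
  ∑∑-cong F≡G = ∑-cong (vertices n) (λ u → ∑-cong (vertices n) (F≡G u))

  ∑∑-distrib-+ : (F G : Vertex → Vertex → ℕ) → ∑∑ n (λ u w → F u w + G u w) ≡ ∑∑ n F + ∑∑ n G
  ∑∑-distrib-+ F G = trans (∑-cong (vertices n) (λ u → ∑-distrib-+ (vertices n) (F u) (G u)))
    (∑-distrib-+ (vertices n) _ _)

  ∑∑-adjacent-comm : (g : Vertex → Vertex → ℕ) →
    ∑∑ n (λ u w → b2n (adjacentᵇ u w) * g u w) ≡ ∑∑ n (λ u w → b2n (adjacentᵇ u w) * g w u)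
  ∑∑-adjacent-comm g = trans (∑-comm V V _) (∑-congᴹ V (λ u u∈V → ∑-congᴹ V (λ w w∈V →
    cong (λ b → b2n b * g w u) (adjacent-comm (∈vertices⇒IsVertex {n} w∈V) (∈vertices⇒IsVertex u∈V)))))
    where V = vertices n

  ∑∑-edges : (g : Vertex → Vertex → ℕ) →
    ∑∑ n (λ u w → b2n (lexLtᵇ u w ∧ adjacentᵇ u w) * (g u w + g w u)) ≡
    ∑∑ n (λ u w → b2n (adjacentᵇ u w) * g u w)
  ∑∑-edges g = begin
    ∑∑ n (λ u w → b2n (lexLtᵇ u w ∧ adjacentᵇ u w) * (g u w + g w u))
      ≡⟨ ∑∑-cong (λ u w → trans (cong (_* (g u w + g w u)) (b2n-∧ (lexLtᵇ u w) _)) (split (b2n (lexLtᵇ u w)) (b2n (adjacentᵇ u w)) (g u w) (g w u))) ⟩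
    ∑∑ n (λ u w → F u w + b2n (adjacentᵇ u w) * (b2n (lexLtᵇ u w) * g w u))
      ≡⟨ ∑∑-distrib-+ F (λ u w → b2n (adjacentᵇ u w) * (b2n (lexLtᵇ u w) * g w u)) ⟩
    ∑∑ n F + ∑∑ n (λ u w → b2n (adjacentᵇ u w) * (b2n (lexLtᵇ u w) * g w u))
      ≡⟨ cong (∑∑ n F +_) (∑∑-adjacent-comm (λ u w → b2n (lexLtᵇ u w) * g w u)) ⟩
    ∑∑ n F + ∑∑ n (λ u w → b2n (adjacentᵇ u w) * (b2n (lexLtᵇ w u) * g u w))
      ≡⟨ ∑∑-distrib-+ F (λ u w → b2n (adjacentᵇ u w) * (b2n (lexLtᵇ w u) * g u w)) ⟨
    ∑∑ n (λ u w → F u w + b2n (adjacentᵇ u w) * (b2n (lexLtᵇ w u) * g u w))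
      ≡⟨ ∑∑-cong (λ u w → trans (merge (b2n (adjacentᵇ u w)) (b2n (lexLtᵇ u w)) (b2n (lexLtᵇ w u)) (g u w)) (cong (_* g u w) (adjacent-lex u w))) ⟩
    ∑∑ n (λ u w → b2n (adjacentᵇ u w) * g u w) ∎
    where
    open ≡-Reasoning
    F : Vertex → Vertex → ℕ
    F u w = b2n (adjacentᵇ u w) * (b2n (lexLtᵇ u w) * g u w)
    split : ∀ l a x y → l * a * (x + y) ≡ a * (l * x) + a * (l * y)
    split = solve-∀
    merge : ∀ a l l' x → a * (l * x) + a * (l' * x) ≡ a * (l + l') * x
    merge = solve-∀

  ∑∈-degree : ∀ A B → ∑∈ n A (degree n B) ≡ ∑∑ n (λ u w → b2n (adjacentᵇ u w) * (b2n (A u) * b2n (B w)))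
  ∑∈-degree A B = ∑-cong (vertices n) (λ u →
    trans (sym (∑-*ˡ (vertices n) (b2n (A u)) _)) (∑-cong (vertices n) (λ w → reorder (b2n (A u)) (b2n (B w)) (b2n (adjacentᵇ u w)))))
    where
    reorder : ∀ a b e → a * (b * e) ≡ e * (a * b)
    reorder = solve-∀

  ∑∈-degree-comm : ∀ A B → ∑∈ n A (degree n B) ≡ ∑∈ n B (degree n A)
  ∑∈-degree-comm A B = begin
    ∑∈ n A (degree n B)                                          ≡⟨ ∑∈-degree A B ⟩
    ∑∑ n (λ u w → b2n (adjacentᵇ u w) * (b2n (A u) * b2n (B w)))  ≡⟨ ∑∑-adjacent-comm (λ u w → b2n (A u) * b2n (B w)) ⟩
    ∑∑ n (λ u w → b2n (adjacentᵇ u w) * (b2n (A w) * b2n (B u)))  ≡⟨ ∑∑-cong (λ u w → cong (b2n (adjacentᵇ u w) *_) (*-comm (b2n (A w)) (b2n (B u)))) ⟩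
    ∑∑ n (λ u w → b2n (adjacentᵇ u w) * (b2n (B u) * b2n (A w)))  ≡⟨ ∑∈-degree B A ⟨
    ∑∈ n B (degree n A)                                          ∎
    where open ≡-Reasoning

  boundary≡∑∈degree : ∀ A → boundary n A ≡ ∑∈ n A (degree n (∁ˢ A))
  boundary≡∑∈degree A = begin
    boundary n A
      ≡⟨ length-filter (edges n) (λ e → A (proj₁ e) xor A (proj₂ e)) ⟩
    ∑ (edges n) (λ e → b2n (A (proj₁ e) xor A (proj₂ e)))
      ≡⟨ ∑-filter pairs (λ e → lexLtᵇ (proj₁ e) (proj₂ e) ∧ adjacentᵇ (proj₁ e) (proj₂ e)) _ ⟩
    ∑ pairs (λ e → b2n (lexLtᵇ (proj₁ e) (proj₂ e) ∧ adjacentᵇ (proj₁ e) (proj₂ e)) * b2n (A (proj₁ e) xor A (proj₂ e)))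
      ≡⟨ trans (∑-concatMap V (λ u → map (λ w → (u , w)) V) _) (∑-cong V (λ u → ∑-map V (λ w → (u , w)) _)) ⟩
    ∑∑ n (λ u w → b2n (lexLtᵇ u w ∧ adjacentᵇ u w) * b2n (A u xor A w))
      ≡⟨ ∑∑-cong (λ u w → cong (b2n (lexLtᵇ u w ∧ adjacentᵇ u w) *_) (b2n-xor (A u) (A w))) ⟩
    ∑∑ n (λ u w → b2n (lexLtᵇ u w ∧ adjacentᵇ u w) * (g u w + g w u))
      ≡⟨ ∑∑-edges g ⟩
    ∑∑ n (λ u w → b2n (adjacentᵇ u w) * g u w)
      ≡⟨ ∑∈-degree A (∁ˢ A) ⟨
    ∑∈ n A (degree n (∁ˢ A)) ∎
    where
    open ≡-Reasoning
    V = vertices n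
    pairs = concatMap (λ u → map (λ w → (u , w)) V) V
    g : Vertex → Vertex → ℕ
    g u w = b2n (A u) * b2n (not (A w))
    b2n-xor : ∀ x y → b2n (x xor y) ≡ b2n x * b2n (not y) + b2n y * b2n (not x)
    b2n-xor true true = refl
    b2n-xor true false = refl
    b2n-xor false true = refl
    b2n-xor false false = refl

  degree-∁-∪ : ∀ {A B} → Disjointˢ A B → ∀ u →
    degree n (∁ˢ A) u ≡ degree n (∁ˢ (A ∪ˢ B)) u + degree n B u
  degree-∁-∪ {A} {B} A∩B=∅ u = trans (∑-cong (vertices n) (λ x →
      trans (cong (_* b2n (adjacentᵇ u x)) (split x)) (*-distribʳ-+ (b2n (adjacentᵇ u x)) (b2n (not (A x ∨ B x))) (b2n (B x)))))
    (∑-distrib-+ (vertices n) _ _)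
    where
    split : ∀ x → b2n (not (A x)) ≡ b2n (not (A x ∨ B x)) + b2n (B x)
    split x with A x in x∈A | B x in x∈B
    ... | true  | true  = ⊥-elim (A∩B=∅ x x∈A x∈B)
    ... | true  | false = refl
    ... | false | true  = refl
    ... | false | false = refl

  -- Both sides count the edges of A to the outside of A ∪ B, those of B to the outside of A ∪ B,
  -- and those between A and B.
  boundary-∪ : ∀ {A B} → Disjointˢ A B →
    boundary n (A ∪ˢ B) + ∑∈ n B (degree n A) ≡ boundary n A + ∑∈ n B (degree n (∁ˢ (A ∪ˢ B)))
  boundary-∪ {A} {B} A∩B=∅ = begin
    boundary n (A ∪ˢ B) + ∑∈ n B (degree n A)
      ≡⟨ cong₂ _+_ (trans (boundary≡∑∈degree (A ∪ˢ B)) (∑∈-∪ n D A∩B=∅)) (∑∈-degree-comm B A) ⟩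
    ∑∈ n A D + ∑∈ n B D + ∑∈ n A (degree n B)
      ≡⟨ +-comm-last (∑∈ n A D) (∑∈ n B D) (∑∈ n A (degree n B)) ⟩
    ∑∈ n A D + ∑∈ n A (degree n B) + ∑∈ n B D
      ≡⟨ cong (_+ ∑∈ n B D) (∑∈-distrib-+ n A D (degree n B)) ⟨
    ∑∈ n A (λ u → D u + degree n B u) + ∑∈ n B D
      ≡⟨ cong (_+ ∑∈ n B D) (∑∈-cong n A (degree-∁-∪ A∩B=∅)) ⟨
    ∑∈ n A (degree n (∁ˢ A)) + ∑∈ n B D
      ≡⟨ cong (_+ ∑∈ n B D) (boundary≡∑∈degree A) ⟨
    boundary n A + ∑∈ n B D ∎
    where
    open ≡-Reasoning
    D : Vertex → ℕ
    D = degree n (∁ˢ (A ∪ˢ B))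
    +-comm-last : ∀ x y z → x + y + z ≡ x + z + y
    +-comm-last = solve-∀

∸-≡ : ∀ m {n d} → m + d ≡ n → n ∸ m ≡ d
∸-≡ m {d = d} refl = m+n∸m≡n m d

≤-by : ∀ {m n} d → m + d ≡ n → m ≤ n
≤-by {m} d refl = m≤m+n m d

[1+m]+n∸m≡1+n : ∀ m n → suc m + n ∸ m ≡ suc n
[1+m]+n∸m≡1+n zero n = refl
[1+m]+n∸m≡1+n (suc m) n = [1+m]+n∸m≡1+n m n

pred+∸suc : ∀ {a m} → 1 ≤ a → a < m → (a ∸ 1) + (m ∸ suc a) ≡ m ∸ 2
pred+∸suc {suc a} {m} _ 1+a<m =
  trans (cong (a +_) (sym (∸-+-assoc m 2 a))) (m+[n∸m]≡n (∸-monoˡ-≤ 2 1+a<m))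

-- Writing i' = 1 + α, i = i' + 1 + β, j = i + 1 + γ, c = j + 1 + τ and n = c + ε turns every
-- truncated difference below into a polynomial in the gaps.
column-j-arith : ∀ {i' i j h} → 1 ≤ i' → i' < i → i < j →
  (j ∸ 2) + (i' ∸ 1) ≤ (i ∸ 1) + (i' ∸ 1) + (h + h + (j ∸ i))
column-j-arith {h = h} (s≤s {n = α} z≤n) i'<i i<j
  with β , refl ← m≤n⇒∃[o]m+o≡n i'<i
  with γ , refl ← m≤n⇒∃[o]m+o≡n i<j =
  subst (λ x → suc (α + β + γ) + α ≤ (suc α + β) + α + (h + h + x)) (sym j∸i)
    (≤-by (1 + h + h) (identity α β γ h))
  where
  identity : ∀ α β γ h → suc (α + β + γ) + α + (1 + h + h) ≡ (suc α + β) + α + (h + h + (1 + γ))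
  identity = solve-∀
  j∸i : (3 + α + β + γ) ∸ (2 + α + β) ≡ 1 + γ
  j∸i = [1+m]+n∸m≡1+n (2 + α + β) γ

column-beyond-identity : ∀ α β γ τ ε →
    (3 + β + γ + τ) * (suc (α + β + γ) + α)
      + (6 + 6 * τ + 6 * ε + 2 * β + β * τ + 2 * β * ε + 2 * γ + 2 * γ * τ + 2 * γ * ε + 2 * τ + 2 * τ * τ + 2 * τ * ε)
    ≡ (3 + β + γ) * (α + (α + β) + ((1 + τ + ε) + (1 + τ + ε) + (1 + γ)))
      + τ * (α + α + ((1 + τ + ε) + (1 + τ + ε) + (1 + γ)))
column-beyond-identity = solve-∀

column-beyond-arith : ∀ {i' i j c n} → 1 ≤ i' → i' < i → i < j → j < c → c ≤ n →
  (c ∸ i') * ((j ∸ 2) + (i' ∸ 1)) ≤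
    (suc j ∸ i') * ((i' ∸ 1) + (i ∸ 2) + ((n ∸ j) + (n ∸ j) + (j ∸ i)))
  + (c ∸ suc j) * ((i' ∸ 1) + (i' ∸ 1) + ((n ∸ j) + (n ∸ j) + (j ∸ i)))
column-beyond-arith (s≤s {n = α} z≤n) i'<i i<j j<c c≤n
  with β , refl ← m≤n⇒∃[o]m+o≡n i'<i
  with γ , refl ← m≤n⇒∃[o]m+o≡n i<j
  with τ , refl ← m≤n⇒∃[o]m+o≡n j<c
  with ε , refl ← m≤n⇒∃[o]m+o≡n c≤n =
  subst₂ _≤_ (cong (_* (suc (α + β + γ) + α)) (sym c∸i'))
    (sym (cong₂ _+_ (cong₂ _*_ 1+j∸i' (cong (α + (α + β) +_) qIn)) (cong₂ _*_ c∸1+j (cong (α + α +_) qIn))))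
    (≤-by (6 + 6 * τ + 6 * ε + 2 * β + β * τ + 2 * β * ε + 2 * γ + 2 * γ * τ + 2 * γ * ε + 2 * τ + 2 * τ * τ + 2 * τ * ε)
      (column-beyond-identity α β γ τ ε))
  where
  c∸i' : (4 + α + β + γ + τ) ∸ (1 + α) ≡ 3 + β + γ + τ
  c∸i' = ∸-≡ (1 + α) (shift α β γ τ)
    where shift : ∀ α β γ τ → (1 + α) + (3 + β + γ + τ) ≡ 4 + α + β + γ + τ
          shift = solve-∀
  1+j∸i' : (4 + α + β + γ) ∸ (1 + α) ≡ 3 + β + γ
  1+j∸i' = ∸-≡ (1 + α) (shift α β γ)
    where shift : ∀ α β γ → (1 + α) + (3 + β + γ) ≡ 4 + α + β + γ
          shift = solve-∀
  c∸1+j : (4 + α + β + γ + τ) ∸ (4 + α + β + γ) ≡ τ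
  c∸1+j = ∸-≡ (4 + α + β + γ) refl
  n∸j : (4 + α + β + γ + τ + ε) ∸ (3 + α + β + γ) ≡ 1 + τ + ε
  n∸j = ∸-≡ (3 + α + β + γ) (shift α β γ τ ε)
    where shift : ∀ α β γ τ ε → (3 + α + β + γ) + (1 + τ + ε) ≡ 4 + α + β + γ + τ + ε
          shift = solve-∀
  j∸i : (3 + α + β + γ) ∸ (2 + α + β) ≡ 1 + γ
  j∸i = [1+m]+n∸m≡1+n (2 + α + β) γ
  qIn : ((4 + α + β + γ + τ + ε) ∸ (3 + α + β + γ)) + ((4 + α + β + γ + τ + ε) ∸ (3 + α + β + γ))
        + ((3 + α + β + γ) ∸ (2 + α + β)) ≡ (1 + τ + ε) + (1 + τ + ε) + (1 + γ)
  qIn = cong₂ _+_ (cong₂ _+_ n∸j n∸j) j∸i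

cross-ratio-≤ : ∀ {b b' s k lo hi} → b' + k * lo ≤ b + k * hi → s * hi ≤ b + s * lo → b' * s ≤ b * (s + k)
cross-ratio-≤ {b} {b'} {s} {k} {lo} {hi} b'≤ s*hi≤ = +-cancelˡ-≤ (k * lo * s) (b' * s) (b * (s + k)) (begin
  k * lo * s + b' * s   ≡⟨ e₁ b' s k lo ⟩
  (b' + k * lo) * s     ≤⟨ *-monoˡ-≤ s b'≤ ⟩
  (b + k * hi) * s      ≡⟨ e₂ b s k hi ⟩
  b * s + k * (s * hi)  ≤⟨ +-monoʳ-≤ (b * s) (*-monoʳ-≤ k s*hi≤) ⟩
  b * s + k * (b + s * lo) ≡⟨ e₃ b s k lo ⟩
  k * lo * s + b * (s + k) ∎)
  where
  open ≤-Reasoning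
  e₁ : ∀ b' s k lo → k * lo * s + b' * s ≡ (b' + k * lo) * s
  e₁ = solve-∀
  e₂ : ∀ b s k hi → (b + k * hi) * s ≡ b * s + k * (s * hi)
  e₂ = solve-∀
  e₃ : ∀ b s k lo → b * s + k * (b + s * lo) ≡ k * lo * s + b * (s + k)
  e₃ = solve-∀

-- The sets S, Q and S'

module Configuration (n i j i' : ℕ) (1≤i' : 1 ≤ i') (i'<i : i' < i) (i<j : i < j) (j<n : j < n) where

  S Q S' : VSet
  S = determined n (i , j) (i' , suc j)
  Q = columnSeg i' i j
  S' = S ∪ˢ Q

  i'≤i : i' ≤ i
  i'≤i = <⇒≤ i'<i

  j≤n : j ≤ n
  j≤n = <⇒≤ j<n

  ∈S⁺ : ∀ x → IsVertex n x → Dominates (i , j) x ⊎ Dominates (i' , suc j) x → x ∈ˢ S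
  ∈S⁺ x x∈V ≼x = reflects-complete (determined-reflects n (i , j) (i' , suc j) x) (x∈V , ≼x)

  ∈S⁻ : ∀ x → x ∈ˢ S → Determined n (i , j) (i' , suc j) x
  ∈S⁻ x = reflects-sound (determined-reflects n (i , j) (i' , suc j) x)

  ∉S : ∀ {a b} → a < i ⊎ b < j → a < i' ⊎ b < suc j → S (a , b) ≡ false
  ∉S {a} {b} outside₁ outside₂ = reflects-refute (determined-reflects n (i , j) (i' , suc j) (a , b)) λ where
    (_ , inj₁ ≼x) → <⇒¬Dominates outside₁ ≼x
    (_ , inj₂ ≼x) → <⇒¬Dominates outside₂ ≼x

  ∈Q⁺ : ∀ {a} → i' ≤ a → a < i → (a , j) ∈ˢ Q
  ∈Q⁺ {a} i'≤a a<i = reflects-complete (columnSeg-reflects i' i j (a , j)) (refl , i'≤a , a<i)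

  ∈Q⁻ : ∀ x → x ∈ˢ Q → ColumnSeg i' i j x
  ∈Q⁻ x = reflects-sound (columnSeg-reflects i' i j x)

  S⊆V : S ⊆ˢ isVertexᵇ n
  S⊆V x x∈S = reflects-complete (isVertex-reflects n x) (proj₁ (∈S⁻ x x∈S))

  S∩Q=∅ : Disjointˢ S Q
  S∩Q=∅ (a , b) x∈S x∈Q with ∈Q⁻ (a , b) x∈Q
  ... | refl , _ , a<i = ∈-∉ S (a , j) x∈S (∉S (inj₁ a<i) (inj₂ (n<1+n j)))

  S'-stable : Stable n S'
  S'-stable u x u∈S' x∈V u≼x with ∈∪⁻ {S} {Q} u u∈S'
  ... | inj₁ u∈S = ∈∪⁺ {S} {Q} x (inj₁ (determined-stable n (i , j) (i' , suc j) u x u∈S x∈V u≼x))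
  ... | inj₂ u∈Q = ∈∪⁺ {S} {Q} x (dominated-by-Q u x (∈Q⁻ u u∈Q) x∈V u≼x)
    where
    dominated-by-Q : ∀ u x → ColumnSeg i' i j u → IsVertex n x → Dominates u x → x ∈ˢ S ⊎ x ∈ˢ Q
    dominated-by-Q (a , b) (c , d) (refl , i'≤a , _) x∈V (a≤c , j≤d) with j <? d | i ≤? c
    ... | yes j<d | _ = inj₁ (∈S⁺ (c , d) x∈V (inj₂ (≤-trans i'≤a a≤c , j<d)))
    ... | no _ | yes i≤c = inj₁ (∈S⁺ (c , d) x∈V (inj₁ (i≤c , j≤d)))
    ... | no j≮d | no i≰c with ≤-antisym j≤d (≮⇒≥ j≮d)
    ...   | refl = inj₂ (∈Q⁺ (≤-trans i'≤a a≤c) (≰⇒> i≰c))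

  below-∉S : ∀ {u y b} → y < u → u ≤ i → u ≤ i' ⊎ b ≤ j → S (y , b) ≡ false
  below-∉S y<u u≤i (inj₁ u≤i') = ∉S (inj₁ (<-≤-trans y<u u≤i)) (inj₁ (<-≤-trans y<u u≤i'))
  below-∉S y<u u≤i (inj₂ b≤j) = ∉S (inj₁ (<-≤-trans y<u u≤i)) (inj₂ (s≤s b≤j))

  column-sharers⊆ : ∀ {u r c} → u ≤ r → r < c → c ≤ n → u ≤ i → u ≤ i' ⊎ c ≤ j →
    columnSeg 1 u c ⊆ˢ neighbours n (∁ˢ S) (r , c)
  column-sharers⊆ {u} {r} {c} u≤r r<c c≤n u≤i low (y , d) x∈
    with reflects-sound (columnSeg-reflects 1 u c (y , d)) x∈
  ... | refl , 1≤y , y<u = ∈neighbours⁺ {X = ∁ˢ S} {u = r , c} (1≤y , <-trans y<r r<c , c≤n)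
    (adjacent-column (>⇒≢ y<r) (<⇒≢ r<c)) (∉⇒∈∁ S (y , c) (below-∉S y<u u≤i low))
    where y<r = <-≤-trans y<u u≤r

  row-sharers⊆ : ∀ {u r c} → u ≤ r → r < c → c ≤ n → u ≤ i → u ≤ i' ⊎ r ≤ j →
    columnSeg 1 u r ⊆ˢ neighbours n (∁ˢ S) (r , c)
  row-sharers⊆ {u} {r} {c} u≤r r<c c≤n u≤i low (y , d) x∈
    with reflects-sound (columnSeg-reflects 1 u r (y , d)) x∈
  ... | refl , 1≤y , y<u = ∈neighbours⁺ {X = ∁ˢ S} {u = r , c} (1≤y , y<r , <⇒≤ (<-≤-trans r<c c≤n))
    (adjacent-row-column (>⇒≢ (<-trans y<r r<c)) (>⇒≢ r<c)) (∉⇒∈∁ S (y , r) (below-∉S y<u u≤i low))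
    where y<r = <-≤-trans y<u u≤r

  qIn qOut : ℕ
  qIn = (n ∸ j) + (n ∸ j) + (j ∸ i)
  qOut = (j ∸ 2) + (i' ∸ 1)

  Q-degree-S : ∀ {a} → i' ≤ a → a < i → qIn ≤ degree n S (a , j)
  Q-degree-S {a} i'≤a a<i = begin
    qIn
      ≡⟨ cong₂ _+_ (cong₂ _+_ (count-rowSeg (suc j) (suc n) a≤n ≤-refl) (count-rowSeg (suc j) (suc n) j≤n ≤-refl))
                   (count-columnSeg i j j≤n (m≤n⇒m≤1+n j≤n)) ⟨
    count n row-a + count n row-j + count n column-j
      ≤⟨ degree-≥-disjoint₃ S (a , j) row-a row-j column-j
           (rowSeg-disjoint (suc j) (suc n) a (suc j) (suc n) j (<⇒≢ a<j))
           (rowSeg-columnSeg-disjoint (suc j) (suc n) a i j j corner)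
           (rowSeg-columnSeg-disjoint (suc j) (suc n) j i j j corner)
           row-a⊆ row-j⊆ column-j⊆ ⟩
    degree n S (a , j) ∎
    where
    open ≤-Reasoning
    a<j = <-trans a<i i<j
    a≤n = <⇒≤ (<-≤-trans a<j j≤n)
    row-a row-j column-j : VSet
    row-a = rowSeg (suc j) (suc n) a
    row-j = rowSeg (suc j) (suc n) j
    column-j = columnSeg i j j
    corner : ∀ {r} → ¬ (Interval (suc j) (suc n) j × Interval i j r)
    corner ((1+j≤j , _) , _) = 1+n≰n 1+j≤j
    row-a⊆ : row-a ⊆ˢ neighbours n S (a , j)
    row-a⊆ (b , d) x∈ with reflects-sound (rowSeg-reflects (suc j) (suc n) a (b , d)) x∈
    ... | refl , j<d , d<1+n = ∈neighbours⁺ {X = S} {u = a , j} x∈V (adjacent-row (>⇒≢ a<j) (<⇒≢ j<d))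
      (∈S⁺ (a , d) x∈V (inj₂ (i'≤a , j<d)))
      where x∈V = ≤-trans 1≤i' i'≤a , <-trans a<j j<d , ≤-pred d<1+n
    row-j⊆ : row-j ⊆ˢ neighbours n S (a , j)
    row-j⊆ (b , d) x∈ with reflects-sound (rowSeg-reflects (suc j) (suc n) j (b , d)) x∈
    ... | refl , j<d , d<1+n = ∈neighbours⁺ {X = S} {u = a , j} x∈V (adjacent-column-row (<⇒≢ a<j) (<⇒≢ (<-trans a<j j<d)))
      (∈S⁺ (j , d) x∈V (inj₁ (<⇒≤ i<j , <⇒≤ j<d)))
      where x∈V = ≤-trans 1≤i' (≤-trans i'≤a (<⇒≤ a<j)) , j<d , ≤-pred d<1+n
    column-j⊆ : column-j ⊆ˢ neighbours n S (a , j)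
    column-j⊆ (y , d) x∈ with reflects-sound (columnSeg-reflects i j j (y , d)) x∈
    ... | refl , i≤y , y<j = ∈neighbours⁺ {X = S} {u = a , j} x∈V (adjacent-column (<⇒≢ (<-≤-trans a<i i≤y)) (<⇒≢ a<j))
      (∈S⁺ (y , j) x∈V (inj₁ (i≤y , ≤-refl)))
      where x∈V = ≤-trans 1≤i' (≤-trans i'≤i i≤y) , y<j , j≤n

  Q-∁S'-neighbours : ∀ {a} → i' ≤ a → a < i → ∀ x → x ∈ˢ neighbours n (∁ˢ S') (a , j) →
    x ∈ˢ columnSeg 1 a a ⊎ x ∈ˢ rowSeg (suc a) j a ⊎ x ∈ˢ columnSeg 1 i' j
  Q-∁S'-neighbours {a} i'≤a a<i (c , d) x∈N with ∈neighbours⁻ {X = ∁ˢ S'} {u = a , j} (c , d) x∈N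
  ... | x∈V@(1≤c , c<d , _) , adj , x∉S' = shares (adjacent⇒shares a j c d adj)
    where
    x∉S : S (c , d) ≡ false
    x∉S = proj₁ (∈∁∪⁻ S Q (c , d) x∉S')
    x∉Q : Q (c , d) ≡ false
    x∉Q = proj₂ (∈∁∪⁻ S Q (c , d) x∉S')
    shares : a ≡ c ⊎ a ≡ d ⊎ j ≡ c ⊎ j ≡ d →
      (c , d) ∈ˢ columnSeg 1 a a ⊎ (c , d) ∈ˢ rowSeg (suc a) j a ⊎ (c , d) ∈ˢ columnSeg 1 i' j
    shares (inj₁ refl) with <-cmp d j
    ... | tri< d<j _ _ = inj₂ (inj₁ (reflects-complete (rowSeg-reflects (suc a) j a (a , d)) (refl , c<d , d<j)))
    ... | tri≈ _ refl _ = ⊥-elim (∈-∉ Q (a , j) (∈Q⁺ i'≤a a<i) x∉Q)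
    ... | tri> _ _ j<d = ⊥-elim (∈-∉ S (a , d) (∈S⁺ (a , d) x∈V (inj₂ (i'≤a , j<d))) x∉S)
    shares (inj₂ (inj₁ refl)) = inj₁ (reflects-complete (columnSeg-reflects 1 a a (c , a)) (refl , 1≤c , c<d))
    shares (inj₂ (inj₂ (inj₁ refl))) = ⊥-elim (∈-∉ S (j , d) (∈S⁺ (j , d) x∈V (inj₁ (<⇒≤ i<j , <⇒≤ c<d))) x∉S)
    shares (inj₂ (inj₂ (inj₂ refl))) with i ≤? c | i' ≤? c
    ... | yes i≤c | _ = ⊥-elim (∈-∉ S (c , j) (∈S⁺ (c , j) x∈V (inj₁ (i≤c , ≤-refl))) x∉S)
    ... | no i≰c | yes i'≤c = ⊥-elim (∈-∉ Q (c , j) (∈Q⁺ i'≤c (≰⇒> i≰c)) x∉Q)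
    ... | no _ | no i'≰c = inj₂ (inj₂ (reflects-complete (columnSeg-reflects 1 i' j (c , j)) (refl , 1≤c , ≰⇒> i'≰c)))

  Q-degree-∁S' : ∀ {a} → i' ≤ a → a < i → degree n (∁ˢ S') (a , j) ≤ qOut
  Q-degree-∁S' {a} i'≤a a<i = begin
    degree n (∁ˢ S') (a , j)
      ≤⟨ degree-≤-cover₃ (∁ˢ S') (a , j) (columnSeg 1 a a) (rowSeg (suc a) j a) (columnSeg 1 i' j)
           (Q-∁S'-neighbours i'≤a a<i) ⟩
    count n (columnSeg 1 a a) + count n (rowSeg (suc a) j a) + count n (columnSeg 1 i' j)
      ≡⟨ cong₂ _+_ (cong₂ _+_ (count-columnSeg 1 a a≤n (m≤n⇒m≤1+n a≤n)) (count-rowSeg (suc a) j a≤n (m≤n⇒m≤1+n j≤n)))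
                   (count-columnSeg 1 i' j≤n (m≤n⇒m≤1+n (≤-trans i'≤i (≤-trans (<⇒≤ i<j) j≤n)))) ⟩
    (a ∸ 1) + (j ∸ suc a) + (i' ∸ 1)
      ≡⟨ cong (_+ (i' ∸ 1)) (pred+∸suc (≤-trans 1≤i' i'≤a) a<j) ⟩
    qOut ∎
    where
    open ≤-Reasoning
    a<j = <-trans a<i i<j
    a≤n = <⇒≤ (<-≤-trans a<j j≤n)

  column-j-degree : ∀ {r} → i ≤ r → r < j → (i ∸ 1) + (i' ∸ 1) ≤ degree n (∁ˢ S) (r , j)
  column-j-degree {r} i≤r r<j = begin
    (i ∸ 1) + (i' ∸ 1)
      ≡⟨ cong₂ _+_ (count-columnSeg 1 i j≤n (m≤n⇒m≤1+n i≤n)) (count-columnSeg 1 i' r≤n (m≤n⇒m≤1+n i'≤n)) ⟨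
    count n (columnSeg 1 i j) + count n (columnSeg 1 i' r)
      ≤⟨ degree-≥-disjoint₂ (∁ˢ S) (r , j) (columnSeg 1 i j) (columnSeg 1 i' r)
           (columnSeg-disjoint 1 i j 1 i' r (>⇒≢ r<j))
           (column-sharers⊆ i≤r r<j j≤n ≤-refl (inj₂ ≤-refl)) (row-sharers⊆ (≤-trans i'≤i i≤r) r<j j≤n i'≤i (inj₁ ≤-refl)) ⟩
    degree n (∁ˢ S) (r , j) ∎
    where
    open ≤-Reasoning
    r≤n = <⇒≤ (<-≤-trans r<j j≤n)
    i≤n = ≤-trans i≤r r≤n
    i'≤n = ≤-trans i'≤i i≤n

  high-row-degree : ∀ {r c} → j < r → r < c → c ≤ n → (i' ∸ 1) + (i' ∸ 1) ≤ degree n (∁ˢ S) (r , c)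
  high-row-degree {r} {c} j<r r<c c≤n = begin
    (i' ∸ 1) + (i' ∸ 1)
      ≡⟨ cong₂ _+_ (count-columnSeg 1 i' c≤n (m≤n⇒m≤1+n i'≤n)) (count-columnSeg 1 i' r≤n (m≤n⇒m≤1+n i'≤n)) ⟨
    count n (columnSeg 1 i' c) + count n (columnSeg 1 i' r)
      ≤⟨ degree-≥-disjoint₂ (∁ˢ S) (r , c) (columnSeg 1 i' c) (columnSeg 1 i' r)
           (columnSeg-disjoint 1 i' c 1 i' r (>⇒≢ r<c))
           (column-sharers⊆ i'≤r r<c c≤n i'≤i (inj₁ ≤-refl)) (row-sharers⊆ i'≤r r<c c≤n i'≤i (inj₁ ≤-refl)) ⟩
    degree n (∁ˢ S) (r , c) ∎
    where
    open ≤-Reasoning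
    r≤n = <⇒≤ (<-≤-trans r<c c≤n)
    i'≤r = <⇒≤ (<-trans (<-trans i'<i i<j) j<r)
    i'≤n = ≤-trans i'≤r r≤n

  middle-row-degree : ∀ {r c} → i ≤ r → r ≤ j → j < c → c ≤ n → (i' ∸ 1) + (i ∸ 1) ≤ degree n (∁ˢ S) (r , c)
  middle-row-degree {r} {c} i≤r r≤j j<c c≤n = begin
    (i' ∸ 1) + (i ∸ 1)
      ≡⟨ cong₂ _+_ (count-columnSeg 1 i' c≤n (m≤n⇒m≤1+n i'≤n)) (count-columnSeg 1 i r≤n (m≤n⇒m≤1+n (≤-trans i≤r r≤n))) ⟨
    count n (columnSeg 1 i' c) + count n (columnSeg 1 i r)
      ≤⟨ degree-≥-disjoint₂ (∁ˢ S) (r , c) (columnSeg 1 i' c) (columnSeg 1 i r)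
           (columnSeg-disjoint 1 i' c 1 i r (>⇒≢ r<c))
           (column-sharers⊆ i'≤r r<c c≤n i'≤i (inj₁ ≤-refl)) (row-sharers⊆ i≤r r<c c≤n ≤-refl (inj₂ r≤j)) ⟩
    degree n (∁ˢ S) (r , c) ∎
    where
    open ≤-Reasoning
    i'≤r = ≤-trans i'≤i i≤r
    r<c = ≤-<-trans r≤j j<c
    r≤n = <⇒≤ (<-≤-trans r<c c≤n)
    i'≤n = ≤-trans i'≤r r≤n

  Q-row-degree : ∀ {r c} → i' ≤ r → r < i → j < c → c ≤ n → (i' ∸ 1) + (i ∸ 2) ≤ degree n (∁ˢ S) (r , c)
  Q-row-degree {r} {c} i'≤r r<i j<c c≤n = begin
    (i' ∸ 1) + (i ∸ 2)
      ≡⟨ cong ((i' ∸ 1) +_) (pred+∸suc (≤-trans 1≤i' i'≤r) r<i) ⟨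
    (i' ∸ 1) + ((r ∸ 1) + (i ∸ suc r))
      ≡⟨ rotate (i' ∸ 1) (r ∸ 1) (i ∸ suc r) ⟩
    (i ∸ suc r) + (i' ∸ 1) + (r ∸ 1)
      ≡⟨ cong₂ _+_ (cong₂ _+_ (count-rowSeg (suc r) i r≤n (m≤n⇒m≤1+n i≤n)) (count-columnSeg 1 i' c≤n (m≤n⇒m≤1+n i'≤n)))
                   (count-columnSeg 1 r r≤n (m≤n⇒m≤1+n r≤n)) ⟨
    count n (rowSeg (suc r) i r) + count n (columnSeg 1 i' c) + count n (columnSeg 1 r r)
      ≤⟨ degree-≥-disjoint₃ (∁ˢ S) (r , c) (rowSeg (suc r) i r) (columnSeg 1 i' c) (columnSeg 1 r r)
           (rowSeg-columnSeg-disjoint (suc r) i r 1 i' c (λ ((_ , c<i) , _) → <⇒≱ c<i (<⇒≤ i<c)))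
           (rowSeg-columnSeg-disjoint (suc r) i r 1 r r (λ ((1+r≤r , _) , _) → 1+n≰n 1+r≤r))
           (columnSeg-disjoint 1 i' c 1 r r (>⇒≢ r<c))
           row⊆ (column-sharers⊆ i'≤r r<c c≤n i'≤i (inj₁ ≤-refl)) (row-sharers⊆ ≤-refl r<c c≤n (<⇒≤ r<i) (inj₂ r≤j)) ⟩
    degree n (∁ˢ S) (r , c) ∎
    where
    open ≤-Reasoning
    r≤j = <⇒≤ (<-trans r<i i<j)
    i<c = <-trans i<j j<c
    r<c = <-trans r<i i<c
    r≤n = <⇒≤ (<-≤-trans r<c c≤n)
    i≤n = <⇒≤ (<-≤-trans i<c c≤n)
    i'≤n = ≤-trans i'≤r r≤n
    rotate : ∀ x y z → x + (y + z) ≡ z + x + y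
    rotate = solve-∀
    row⊆ : rowSeg (suc r) i r ⊆ˢ neighbours n (∁ˢ S) (r , c)
    row⊆ (b , d) x∈ with reflects-sound (rowSeg-reflects (suc r) i r (b , d)) x∈
    ... | refl , r<d , d<i = ∈neighbours⁺ {X = ∁ˢ S} {u = r , c} (≤-trans 1≤i' i'≤r , r<d , <⇒≤ (<-≤-trans d<i i≤n))
      (adjacent-row (>⇒≢ r<c) (>⇒≢ (<-trans d<i i<c)))
      (∉⇒∈∁ S (r , d) (∉S (inj₁ r<i) (inj₂ (<-trans (<-trans d<i i<j) (n<1+n j)))))

  low-row-degree : ∀ {r c} → i' ≤ r → r ≤ j → j < c → c ≤ n → (i' ∸ 1) + (i ∸ 2) ≤ degree n (∁ˢ S) (r , c)
  low-row-degree {r} i'≤r r≤j j<c c≤n with i ≤? r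
  ... | yes i≤r = ≤-trans (+-monoʳ-≤ (i' ∸ 1) (∸-monoʳ-≤ i (s≤s z≤n))) (middle-row-degree i≤r r≤j j<c c≤n)
  ... | no i≰r = Q-row-degree i'≤r (≰⇒> i≰r) j<c c≤n

  shiftedDegree : Vertex → ℕ
  shiftedDegree x = degree n (∁ˢ S) x + qIn

  column-≤j-bound : ∀ {r c} → c ≤ j → (r , c) ∈ˢ S → qOut ≤ shiftedDegree (r , c)
  column-≤j-bound {r} {c} c≤j r∈S with ∈S⁻ (r , c) r∈S
  ... | _ , inj₂ (_ , 1+j≤c) = ⊥-elim (1+n≰n (≤-trans 1+j≤c c≤j))
  ... | (_ , r<c , _) , inj₁ (i≤r , j≤c) with ≤-antisym j≤c c≤j
  ...   | refl = ≤-trans (column-j-arith {h = n ∸ j} 1≤i' i'<i i<j) (+-monoˡ-≤ qIn (column-j-degree i≤r r<c))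

  S-column≡interval : ∀ {c} → j < c → c ≤ n → ∀ r → S (r , c) ≡ intervalᵇ i' c r
  S-column≡interval {c} j<c c≤n r = reflects-≡ (determined-reflects n (i , j) (i' , suc j) (r , c)) (interval-reflects i' c r)
    (λ where ((_ , r<c , _) , inj₁ (i≤r , _)) → ≤-trans i'≤i i≤r , r<c
             ((_ , r<c , _) , inj₂ (i'≤r , _)) → i'≤r , r<c)
    (λ (i'≤r , r<c) → (≤-trans 1≤i' i'≤r , r<c , c≤n) , inj₂ (i'≤r , j<c))

  column-beyond-j-bound : ∀ {c} → j < c → c ≤ n →
    ∑ (upTo (suc n)) (λ r → b2n (S (r , c)) * qOut) ≤ ∑ (upTo (suc n)) (λ r → b2n (S (r , c)) * shiftedDegree (r , c))
  column-beyond-j-bound {c} j<c c≤n = begin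
    ∑ N (λ r → b2n (S (r , c)) * qOut)
      ≡⟨ ∑-cong N (λ r → cong (λ b → b2n b * qOut) (S-column≡interval j<c c≤n r)) ⟩
    ∑ N (λ r → b2n (intervalᵇ i' c r) * qOut)
      ≡⟨ trans (∑-*ʳ N qOut (λ r → b2n (intervalᵇ i' c r))) (cong (_* qOut) (∑-upTo-intervalᵇ i' c (m≤n⇒m≤1+n c≤n))) ⟩
    (c ∸ i') * qOut
      ≤⟨ column-beyond-arith 1≤i' i'<i i<j j<c c≤n ⟩
    (suc j ∸ i') * ((i' ∸ 1) + (i ∸ 2) + qIn) + (c ∸ suc j) * ((i' ∸ 1) + (i' ∸ 1) + qIn)
      ≤⟨ +-mono-≤ (∑-upTo-intervalᵇ-≥ g (s≤s (<⇒≤ (<-≤-trans j<c c≤n))) low)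
                  (∑-upTo-intervalᵇ-≥ g (m≤n⇒m≤1+n c≤n) high) ⟩
    ∑ N (λ r → b2n (intervalᵇ i' (suc j) r) * g r) + ∑ N (λ r → b2n (intervalᵇ (suc j) c r) * g r)
      ≡⟨ ∑-intervalᵇ-split (≤-trans i'≤i (<⇒≤ (<-trans i<j (n<1+n j)))) j<c N g ⟨
    ∑ N (λ r → b2n (intervalᵇ i' c r) * g r)
      ≡⟨ ∑-cong N (λ r → cong (λ b → b2n b * g r) (S-column≡interval j<c c≤n r)) ⟨
    ∑ N (λ r → b2n (S (r , c)) * shiftedDegree (r , c)) ∎
    where
    open ≤-Reasoning
    N = upTo (suc n)
    g : ℕ → ℕ
    g r = shiftedDegree (r , c)
    low : ∀ r → Interval i' (suc j) r → (i' ∸ 1) + (i ∸ 2) + qIn ≤ g r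
    low r (i'≤r , r<1+j) = +-monoˡ-≤ qIn (low-row-degree i'≤r (≤-pred r<1+j) j<c c≤n)
    high : ∀ r → Interval (suc j) c r → (i' ∸ 1) + (i' ∸ 1) + qIn ≤ g r
    high r (j<r , r<c) = +-monoˡ-≤ qIn (high-row-degree j<r r<c c≤n)

  -- The bound qOut ≤ shiftedDegree x fails for some x in the rows r > j of a column c > j;
  -- it holds on average over every column.
  S-average : card n S * qOut ≤ boundary n S + card n S * qIn
  S-average = begin
    card n S * qOut
      ≡⟨ ∑∈-const n S qOut ⟨
    ∑∈ n S (λ _ → qOut)
      ≡⟨ ∑∈-by-columns n S (λ _ → qOut) S⊆V ⟩
    ∑ N (λ c → ∑ N (λ r → b2n (S (r , c)) * qOut))
      ≤⟨ ∑-monoᴹ-≤ N (λ c c∈N → column (≤-pred (∈-upTo⁻ c∈N))) ⟩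
    ∑ N (λ c → ∑ N (λ r → b2n (S (r , c)) * shiftedDegree (r , c)))
      ≡⟨ ∑∈-by-columns n S shiftedDegree S⊆V ⟨
    ∑∈ n S shiftedDegree
      ≡⟨ ∑∈-distrib-+ n S (degree n (∁ˢ S)) (λ _ → qIn) ⟩
    ∑∈ n S (degree n (∁ˢ S)) + ∑∈ n S (λ _ → qIn)
      ≡⟨ cong₂ _+_ (sym (boundary≡∑∈degree n S)) (∑∈-const n S qIn) ⟩
    boundary n S + card n S * qIn ∎
    where
    open ≤-Reasoning
    N = upTo (suc n)
    column : ∀ {c} → c ≤ n →
      ∑ N (λ r → b2n (S (r , c)) * qOut) ≤ ∑ N (λ r → b2n (S (r , c)) * shiftedDegree (r , c))
    column {c} c≤n with j <? c
    ... | yes j<c = column-beyond-j-bound j<c c≤n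
    ... | no j≮c = ∑-mono-≤ N (λ r → b2n-*-monoʳ-≤ (S (r , c)) (column-≤j-bound (≮⇒≥ j≮c)))

  boundary-S'-≤ : boundary n S' + card n Q * qIn ≤ boundary n S + card n Q * qOut
  boundary-S'-≤ = begin
    boundary n S' + card n Q * qIn                 ≤⟨ +-monoʳ-≤ (boundary n S') (card-*-≤-∑∈ n Q Q-in) ⟩
    boundary n S' + ∑∈ n Q (degree n S)            ≡⟨ boundary-∪ n S∩Q=∅ ⟩
    boundary n S + ∑∈ n Q (degree n (∁ˢ S'))       ≤⟨ +-monoʳ-≤ (boundary n S) (∑∈-≤-card-* n Q Q-out) ⟩
    boundary n S + card n Q * qOut                 ∎
    where
    open ≤-Reasoning
    Q-in : ∀ x → x ∈ˢ Q → qIn ≤ degree n S x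
    Q-in x x∈Q with ∈Q⁻ x x∈Q
    ... | refl , i'≤a , a<i = Q-degree-S i'≤a a<i
    Q-out : ∀ x → x ∈ˢ Q → degree n (∁ˢ S') x ≤ qOut
    Q-out x x∈Q with ∈Q⁻ x x∈Q
    ... | refl , i'≤a , a<i = Q-degree-∁S' i'≤a a<i

lemma3 : (n i j i' : ℕ) → 1 ≤ n → IsVertex n (i , j) → IsVertex n (i' , suc j) → i' < i →
    Stable n (determined n (i , j) (i' , suc j) ∪ˢ columnSeg i' i j)
    × (boundary n (determined n (i , j) (i' , suc j) ∪ˢ columnSeg i' i j)
         * card n (determined n (i , j) (i' , suc j))
       ≤ boundary n (determined n (i , j) (i' , suc j))
         * card n (determined n (i , j) (i' , suc j) ∪ˢ columnSeg i' i j))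
lemma3 n i j i' _ (_ , i<j , _) (1≤i' , _ , j<n) i'<i =
  S'-stable ,
  subst (λ s' → boundary n S' * card n S ≤ boundary n S * s') (sym (card-∪ n S∩Q=∅))
    (cross-ratio-≤ {boundary n S} {boundary n S'} {card n S} {card n Q} {qIn} {qOut} boundary-S'-≤ S-average)
  where open Configuration n i j i' 1≤i' i'<i i<j j<n
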